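{- For each pair $(n, L)$ in $\{(3,15),\ (4,46),\ (5,88),\ (6,159),\ (7,258),\ (8,395)\}$ there exists a non-crossing knight's path of length $L$ in the $n\times n\times n$ cube. Such a path visits $L+1$ distinct cells, i.e. $16/27$, $47/64$, $89/125$, $160/216$, $259/343$ and $396/512$ of the cells respectively.
   Context: An $a\times b\times c$ cuboid is the set of cells $B=\{0,\dots,a-1\}\times\{0,\dots,b-1\}\times\{0,\dots,c-1\}\subset\mathbb{Z}^3$. Each cell is identified with its centre, a point of $\mathbb{R}^3$. The $n\times n\times n$ cube is the $n\times n\times n$ cuboid. A (three-dimensional) knight move from cell $u$ to cell $v$ is allowed when the multiset of absolute values of the coordinates of $v-u$ is $\{0,1,2\}$. A non-crossing knight's path of length $L$ in $B$ is a sequence of cells $v_0,v_1,\dots,v_L\in B$ with the following properties: - the $v_i$ are pairwise distinct; - each step from $v_{i-1}$ to $v_i$ is a knight move; - the straight closed segments $s_i=[v_{i-1},v_i]\subset\mathbb{R}^3$ ($1\le i\le L$) satisfy two conditions. First, $s_i\cap s_{i+1}=\{v_i\}$ for each $i$. Second, $s_i\cap s_j=\emptyset$ whenever $|i-j|\ge 2$. The length of the path is its number of moves $L$.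
   Formalization: The non-crossing conditions on the segments $s_i$ quantify only over points of ℚ³ rather than ℝ³. -}

module Defs where

open import Data.Nat as ℕ using (ℕ; suc; _<_; ∣_-_∣)
open import Data.Fin using (Fin; toℕ; inject₁) renaming (suc to fsuc)
open import Data.Product using (_×_; _,_; Σ)
open import Data.List using (List; _∷_; [])
open import Data.List.Relation.Binary.Permutation.Propositional using (_↭_)
open import Data.Rational as ℚ using (ℚ; 0ℚ; 1ℚ; _+_; _-_; _*_)
open import Data.Empty using (⊥)
open import Data.Integer using (+_)
open import Function.Definitions using (Injective)
open import Relation.Binary.PropositionalEquality using (_≡_)

Cell : Set
Cell = ℕ × ℕ × ℕ

InCuboid : ℕ → ℕ → ℕ → Cell → Set
InCuboid a b c (x , y , z) = (x < a) × (y < b) × (z < c)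

InCube : ℕ → Cell → Set
InCube n = InCuboid n n n

KnightMove : Cell → Cell → Set
KnightMove (x , y , z) (x' , y' , z') =
  (∣ x - x' ∣ ∷ ∣ y - y' ∣ ∷ ∣ z - z' ∣ ∷ []) ↭ (0 ∷ 1 ∷ 2 ∷ [])

Point : Set
Point = ℚ × ℚ × ℚ

centre : Cell → Point
centre (x , y , z) = (+ x ℚ./ 1 , + y ℚ./ 1 , + z ℚ./ 1)

OnSegment : Point → Point → Point → Set
OnSegment (px , py , pz) (ux , uy , uz) (vx , vy , vz) =
  Σ ℚ λ t → (0ℚ ℚ.≤ t) × (t ℚ.≤ 1ℚ)
    × (px ≡ ux + t * (vx - ux))
    × (py ≡ uy + t * (vy - uy))
    × (pz ≡ uz + t * (vz - uz))

record NonCrossingKnightPath (n L : ℕ) : Set where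
  field
    v : Fin (suc L) → Cell
    inCube : ∀ i → InCube n (v i)
    distinct : Injective _≡_ _≡_ v
    moves : ∀ (i : Fin L) → KnightMove (v (inject₁ i)) (v (fsuc i))
  -- the i-th segment (0-based here; s_{i+1} in the paper) joins v i and v (i+1)
  OnSeg : Fin L → Point → Set
  OnSeg i p = OnSegment p (centre (v (inject₁ i))) (centre (v (fsuc i)))
  field
    adjacent : ∀ (i j : Fin L) → suc (toℕ i) ≡ toℕ j →
               ∀ p → OnSeg i p → OnSeg j p → p ≡ centre (v (fsuc i))
    disjoint : ∀ (i j : Fin L) → 2 ℕ.≤ ∣ toℕ i - toℕ j ∣ →
               ∀ p → OnSeg i p → OnSeg j p → ⊥

module Submission where

-- The paths were found by computer search and are verified by evaluation.  The only
-- conditions that are not finite checks concern segments, and each is reduced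
-- to integer inequalities by a linear form f with small integer coefficients: along a
-- segment f interpolates linearly between its values at the two endpoints.  Hence two
-- segments are disjoint as soon as f is smaller at both endpoints of one than at both
-- endpoints of the other, and consecutive segments [a,w] and [w,c] meet only in w as soon
-- as f is strictly monotone along a, w, c.

open import Defs
open import Data.Nat using (ℕ)
open import Data.Product using (_×_; _,_)
open import Data.List using (List; _∷_; [])
open import Data.List.Relation.Unary.All using (All)

open import Data.Empty using (⊥)
open import Data.Sum as Sum using (_⊎_; inj₁; inj₂)
open import Data.Product as Product using (proj₁; uncurry)
open import Data.Product.Properties using () renaming (≡-dec to ×-≡-dec)
open import Function using (_∘_; _on_)
open import Relation.Binary.PropositionalEquality
  using (_≡_; refl; sym; trans; cong; cong₂; subst; subst₂; module ≡-Reasoning)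
open import Relation.Nullary using (¬_; ¬?; yes)
open import Relation.Nullary.Decidable using (Dec; True; toWitness; _×-dec_; _⊎-dec_; map′)
open import Relation.Unary using (Decidable)

import Data.Nat as ℕ
import Data.Nat.Properties as ℕ
open import Data.Nat using (suc; zero; z≤n; s≤s; ∣_-_∣)
import Data.Nat.Coprimality as Coprime
open import Data.Integer as ℤ using (ℤ; +_)
import Data.Integer.Properties as ℤ
open import Data.Rational as ℚ using (ℚ; 0ℚ; 1ℚ; _+_; _-_; _*_; -_; _≤_; _<_; _⊔_; _⊓_; *≤*; *<*)
open import Data.Rational.Literals using (fromℤ)
import Data.Rational.Properties as ℚ
open import Data.Rational.Solver using (module +-*-Solver)
open import Data.Fin using (Fin; toℕ; inject₁) renaming (zero to fzero; suc to fsuc)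
import Data.Fin.Properties as Fin
open import Data.Vec using (Vec; lookup; _∷_; [])
import Data.Vec.Relation.Unary.All as VecAll
import Data.Vec.Relation.Unary.All.Properties as VecAll
open import Data.Vec.Relation.Unary.AllPairs using (allPairs?)
open import Data.Vec.Relation.Unary.Linked using (Linked; _∷_; linked?)
open import Data.Vec.Relation.Unary.Unique.Propositional using (Unique)
open import Data.Vec.Relation.Unary.Unique.Propositional.Properties using (lookup-injective)
import Data.List.Relation.Unary.All as ListAll
open ListAll using (_∷_; [])
open import Data.List.Relation.Unary.Any using (Any; any?; satisfied)
import Data.List.Properties as List
open import Data.List.Membership.Propositional using (_∈_)
open import Data.List.Membership.DecPropositional (List.≡-dec ℕ._≟_) using (_∈?_)
import Data.List.Relation.Binary.Permutation.Propositional as Perm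
open Perm using (_↭_)

/1≡fromℤ : ∀ a → a ℚ./ 1 ≡ fromℤ a
/1≡fromℤ (+ n)      = ℚ.normalize-coprime (Coprime.sym (Coprime.1-coprimeTo n))
/1≡fromℤ ℤ.-[1+ n ] = cong -_ (ℚ.normalize-coprime (Coprime.sym (Coprime.1-coprimeTo (suc n))))

fromℤ-+ : ∀ a b → fromℤ a + fromℤ b ≡ fromℤ (a ℤ.+ b)
fromℤ-+ a b = trans (cong (ℚ._/ 1) (cong₂ ℤ._+_ (ℤ.*-identityʳ a) (ℤ.*-identityʳ b))) (/1≡fromℤ _)

fromℤ-* : ∀ a b → fromℤ a * fromℤ b ≡ fromℤ (a ℤ.* b)
fromℤ-* a b = /1≡fromℤ (a ℤ.* b)

fromℤ-mono-≤ : ∀ {a b} → a ℤ.≤ b → fromℤ a ≤ fromℤ b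
fromℤ-mono-≤ {a} {b} = *≤* ∘ subst₂ ℤ._≤_ (sym (ℤ.*-identityʳ a)) (sym (ℤ.*-identityʳ b))

fromℤ-mono-< : ∀ {a b} → a ℤ.< b → fromℤ a < fromℤ b
fromℤ-mono-< {a} {b} = *<* ∘ subst₂ ℤ._<_ (sym (ℤ.*-identityʳ a)) (sym (ℤ.*-identityʳ b))

fromℤ-⊔-≤ : ∀ a b → fromℤ a ⊔ fromℤ b ≤ fromℤ (a ℤ.⊔ b)
fromℤ-⊔-≤ a b = ℚ.⊔-lub (fromℤ-mono-≤ (ℤ.i≤i⊔j a b)) (fromℤ-mono-≤ (ℤ.i≤j⊔i a b))

fromℤ-⊓-≥ : ∀ a b → fromℤ (a ℤ.⊓ b) ≤ fromℤ a ⊓ fromℤ b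
fromℤ-⊓-≥ a b = ℚ.⊓-glb (fromℤ-mono-≤ (ℤ.i⊓j≤i a b)) (fromℤ-mono-≤ (ℤ.i⊓j≤j a b))

data StrictlyMonotone {A : Set} (_≺_ : A → A → Set) (a w c : A) : Set where
  increasing : a ≺ w → w ≺ c → StrictlyMonotone _≺_ a w c
  decreasing : c ≺ w → w ≺ a → StrictlyMonotone _≺_ a w c

strictlyMonotone? : ∀ {A : Set} {_≺_ : A → A → Set} → (∀ x y → Dec (x ≺ y)) →
  ∀ a w c → Dec (StrictlyMonotone _≺_ a w c)
strictlyMonotone? _≺?_ a w c =
  map′ Sum.[ uncurry increasing , uncurry decreasing ] split
    ((a ≺? w ×-dec w ≺? c) ⊎-dec (c ≺? w ×-dec w ≺? a))
  where
  split : StrictlyMonotone _ a w c → _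
  split (increasing p q) = inj₁ (p , q)
  split (decreasing p q) = inj₂ (p , q)

strictlyMonotone-map : ∀ {A B : Set} {_≺_ : A → A → Set} {_⊏_ : B → B → Set} {a w c}
  (g : A → B) → (∀ {x y} → x ≺ y → g x ⊏ g y) →
  StrictlyMonotone _≺_ a w c → StrictlyMonotone _⊏_ (g a) (g w) (g c)
strictlyMonotone-map g mono (increasing p q) = increasing (mono p) (mono q)
strictlyMonotone-map g mono (decreasing p q) = decreasing (mono p) (mono q)

lerp : ℚ → ℚ → ℚ → ℚ
lerp a b t = a + t * (b - a)

module _ where
  open +-*-Solver

  lerp-convex : ∀ a b t → lerp a b t ≡ (1ℚ - t) * a + t * b
  lerp-convex = solve 3 (λ a b t → a :+ t :* (b :- a) := (con 1ℚ :- t) :* a :+ t :* b) refl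

  convex-const : ∀ m t → (1ℚ - t) * m + t * m ≡ m
  convex-const = solve 2 (λ m t → (con 1ℚ :- t) :* m :+ t :* m := m) refl

  lerp-zero : ∀ a b → lerp a b 0ℚ ≡ a
  lerp-zero = solve 2 (λ a b → a :+ con 0ℚ :* (b :- a) := a) refl

  neg-lerp : ∀ a b t → - lerp a b t ≡ lerp (- a) (- b) t
  neg-lerp = solve 3 (λ a b t → :- (a :+ t :* (b :- a)) := (:- a) :+ t :* ((:- b) :- (:- a))) refl

  lerp-linear : ∀ a b c t x₀ y₀ z₀ x₁ y₁ z₁ →
    a * lerp x₀ x₁ t + b * lerp y₀ y₁ t + c * lerp z₀ z₁ t ≡
    lerp (a * x₀ + b * y₀ + c * z₀) (a * x₁ + b * y₁ + c * z₁) t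
  lerp-linear = solve 10 (λ a b c t x₀ y₀ z₀ x₁ y₁ z₁ →
    a :* (x₀ :+ t :* (x₁ :- x₀)) :+ b :* (y₀ :+ t :* (y₁ :- y₀)) :+ c :* (z₀ :+ t :* (z₁ :- z₀))
    := (a :* x₀ :+ b :* y₀ :+ c :* z₀)
       :+ t :* ((a :* x₁ :+ b :* y₁ :+ c :* z₁) :- (a :* x₀ :+ b :* y₀ :+ c :* z₀))) refl

t≤1⇒0≤1-t : ∀ {t} → t ≤ 1ℚ → 0ℚ ≤ 1ℚ - t
t≤1⇒0≤1-t {t} t≤1 = subst (_≤ 1ℚ - t) (ℚ.+-inverseʳ t) (ℚ.+-monoˡ-≤ (- t) t≤1)

module _ {a b t : ℚ} (0≤t : 0ℚ ≤ t) (t≤1 : t ≤ 1ℚ) where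
  private instance
    _ = ℚ.nonNegative 0≤t
    _ = ℚ.nonNegative (t≤1⇒0≤1-t t≤1)

  lerp-≤ : ∀ {m} → a ≤ m → b ≤ m → lerp a b t ≤ m
  lerp-≤ {m} a≤m b≤m = subst₂ _≤_ (sym (lerp-convex a b t)) (convex-const m t)
    (ℚ.+-mono-≤ (ℚ.*-monoˡ-≤-nonNeg (1ℚ - t) a≤m) (ℚ.*-monoˡ-≤-nonNeg t b≤m))

  ≤-lerp : ∀ {m} → m ≤ a → m ≤ b → m ≤ lerp a b t
  ≤-lerp {m} m≤a m≤b = subst₂ _≤_ (convex-const m t) (sym (lerp-convex a b t))
    (ℚ.+-mono-≤ (ℚ.*-monoˡ-≤-nonNeg (1ℚ - t) m≤a) (ℚ.*-monoˡ-≤-nonNeg t m≤b))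

  lerp-≤-⊔ : lerp a b t ≤ a ⊔ b
  lerp-≤-⊔ = lerp-≤ (ℚ.p≤p⊔q a b) (ℚ.p≤q⊔p a b)

  ⊓-≤-lerp : a ⊓ b ≤ lerp a b t
  ⊓-≤-lerp = ≤-lerp (ℚ.p⊓q≤p a b) (ℚ.p⊓q≤q a b)

b<a⇒lerp<a : ∀ {a b t} → 0ℚ < t → b < a → lerp a b t < a
b<a⇒lerp<a {a} {b} {t} 0<t b<a = begin-strict
  a + t * (b - a)  <⟨ ℚ.+-monoʳ-< a t[b-a]<0 ⟩
  a + 0ℚ           ≡⟨ ℚ.+-identityʳ a ⟩
  a                ∎
  where
  open ℚ.≤-Reasoning
  instance _ = ℚ.positive 0<t
  t[b-a]<0 : t * (b - a) < 0ℚ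
  t[b-a]<0 = subst (t * (b - a) <_) (ℚ.*-zeroʳ t)
    (ℚ.*-monoʳ-<-pos t (subst (b - a <_) (ℚ.+-inverseʳ a) (ℚ.+-monoˡ-< (- a) b<a)))

lerp≡lerp⇒≡0 : ∀ {a w c t s} → StrictlyMonotone _<_ a w c →
  0ℚ ≤ t → t ≤ 1ℚ → 0ℚ ≤ s → lerp a w t ≡ lerp w c s → s ≡ 0ℚ
lerp≡lerp⇒≡0 {a} {w} {c} (decreasing c<w w<a) 0≤t t≤1 0≤s eq = ℚ.≤-antisym (ℚ.≮⇒≥ s≯0) 0≤s
  where
  s≯0 : ¬ 0ℚ < _
  s≯0 0<s = ℚ.<-irrefl refl (ℚ.≤-<-trans
    (subst (w ≤_) eq (≤-lerp 0≤t t≤1 (ℚ.<⇒≤ w<a) ℚ.≤-refl)) (b<a⇒lerp<a 0<s c<w))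
lerp≡lerp⇒≡0 {a} {w} {c} {t} {s} (increasing a<w w<c) 0≤t t≤1 0≤s eq =
  lerp≡lerp⇒≡0 (decreasing (ℚ.neg-antimono-< w<c) (ℚ.neg-antimono-< a<w)) 0≤t t≤1 0≤s (begin
    lerp (- a) (- w) t  ≡⟨ neg-lerp a w t ⟨
    - lerp a w t        ≡⟨ cong -_ eq ⟩
    - lerp w c s        ≡⟨ neg-lerp w c s ⟩
    lerp (- w) (- c) s  ∎)
  where open ≡-Reasoning

segments : ∀ {A : Set} {n} → Vec A (suc n) → Vec (A × A) n
segments (x ∷ [])     = []
segments (x ∷ y ∷ ys) = (x , y) ∷ segments (y ∷ ys)

lookup-segments : ∀ {A : Set} {n} (xs : Vec A (suc n)) i →
  lookup (segments xs) i ≡ (lookup xs (inject₁ i) , lookup xs (fsuc i))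
lookup-segments (x ∷ y ∷ ys) fzero    = refl
lookup-segments (x ∷ y ∷ ys) (fsuc i) = lookup-segments (y ∷ ys) i

linked-lookup : ∀ {A : Set} {R : A → A → Set} {n} {xs : Vec A n} → Linked R xs →
  ∀ i j → suc (toℕ i) ≡ toℕ j → R (lookup xs i) (lookup xs j)
linked-lookup {xs = _ ∷ _ ∷ _} (r ∷ _) fzero (fsuc fzero) _ = r
linked-lookup (_ ∷ rs) (fsuc i) (fsuc j) eq = linked-lookup rs i j (ℕ.suc-injective eq)

data AllNonAdjacent {A : Set} (R : A → A → Set) : ∀ {n} → Vec A n → Set where
  []  : AllNonAdjacent R []
  [-] : ∀ {x} → AllNonAdjacent R (x ∷ [])
  _∷_ : ∀ {n x y} {ys : Vec A n} →
        VecAll.All (R x) ys → AllNonAdjacent R (y ∷ ys) → AllNonAdjacent R (x ∷ y ∷ ys)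

allNonAdjacent? : ∀ {A : Set} {R : A → A → Set} → (∀ x y → Dec (R x y)) →
  ∀ {n} (xs : Vec A n) → Dec (AllNonAdjacent R xs)
allNonAdjacent? R? []           = yes []
allNonAdjacent? R? (x ∷ [])     = yes [-]
allNonAdjacent? R? (x ∷ y ∷ ys) = map′ (uncurry _∷_) (λ { (r ∷ rs) → r , rs })
  (VecAll.all? (R? x) ys ×-dec allNonAdjacent? R? (y ∷ ys))

allNonAdjacent-lookup : ∀ {A : Set} {R : A → A → Set} {n} {xs : Vec A n} →
  AllNonAdjacent R xs → ∀ i j → suc (toℕ i) ℕ.< toℕ j → R (lookup xs i) (lookup xs j)
allNonAdjacent-lookup (r ∷ _)  fzero    (fsuc (fsuc j)) _           = VecAll.lookup⁺ r j
allNonAdjacent-lookup (_ ∷ _)  fzero    (fsuc fzero)    (s≤s ())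
allNonAdjacent-lookup (_ ∷ rs) (fsuc i) (fsuc j)        (s≤s i+1<j) =
  allNonAdjacent-lookup rs i j i+1<j

2≤∣m-n∣⇒1+m<n⊎1+n<m : ∀ m n → 2 ℕ.≤ ∣ m - n ∣ → suc m ℕ.< n ⊎ suc n ℕ.< m
2≤∣m-n∣⇒1+m<n⊎1+n<m zero          (suc zero)    (s≤s ())
2≤∣m-n∣⇒1+m<n⊎1+n<m zero          (suc (suc n)) _ = inj₁ (s≤s (s≤s z≤n))
2≤∣m-n∣⇒1+m<n⊎1+n<m (suc zero)    zero          (s≤s ())
2≤∣m-n∣⇒1+m<n⊎1+n<m (suc (suc m)) zero          _ = inj₂ (s≤s (s≤s z≤n))
2≤∣m-n∣⇒1+m<n⊎1+n<m (suc m)       (suc n)       h =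
  Sum.map s≤s s≤s (2≤∣m-n∣⇒1+m<n⊎1+n<m m n h)

LinearForm : Set
LinearForm = ℤ × ℤ × ℤ

eval : LinearForm → Cell → ℤ
eval (a , b , c) (x , y , z) = a ℤ.* + x ℤ.+ b ℤ.* + y ℤ.+ c ℤ.* + z

evalℚ : LinearForm → Point → ℚ
evalℚ (a , b , c) (x , y , z) = fromℤ a * x + fromℤ b * y + fromℤ c * z

evalℚ-centre : ∀ f u → evalℚ f (centre u) ≡ fromℤ (eval f u)
evalℚ-centre (a , b , c) (x , y , z) = begin
  a′ * (+ x ℚ./ 1) + b′ * (+ y ℚ./ 1) + c′ * (+ z ℚ./ 1)
    ≡⟨ cong₂ _+_ (cong₂ _+_ (term a x) (term b y)) (term c z) ⟩
  fromℤ (a ℤ.* + x) + fromℤ (b ℤ.* + y) + fromℤ (c ℤ.* + z)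
    ≡⟨ cong (_+ fromℤ (c ℤ.* + z)) (fromℤ-+ (a ℤ.* + x) (b ℤ.* + y)) ⟩
  fromℤ (a ℤ.* + x ℤ.+ b ℤ.* + y) + fromℤ (c ℤ.* + z)
    ≡⟨ fromℤ-+ (a ℤ.* + x ℤ.+ b ℤ.* + y) (c ℤ.* + z) ⟩
  fromℤ (eval (a , b , c) (x , y , z)) ∎
  where
  open ≡-Reasoning
  a′ = fromℤ a
  b′ = fromℤ b
  c′ = fromℤ c
  term : ∀ k n → fromℤ k * (+ n ℚ./ 1) ≡ fromℤ (k ℤ.* + n)
  term k n = trans (cong (fromℤ k *_) (/1≡fromℤ (+ n))) (fromℤ-* k (+ n))

evalℚ-onSegment : ∀ f {p} u v (o : OnSegment p u v) →
  evalℚ f p ≡ lerp (evalℚ f u) (evalℚ f v) (proj₁ o)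
evalℚ-onSegment (a , b , c) (x₀ , y₀ , z₀) (x₁ , y₁ , z₁) (t , _ , _ , refl , refl , refl) =
  lerp-linear (fromℤ a) (fromℤ b) (fromℤ c) t x₀ y₀ z₀ x₁ y₁ z₁

onSegment-start : ∀ {p u} v (o : OnSegment p u v) → proj₁ o ≡ 0ℚ → p ≡ u
onSegment-start (x₁ , y₁ , z₁) (_ , _ , _ , refl , refl , refl) refl =
  cong₂ _,_ (lerp-zero _ x₁) (cong₂ _,_ (lerp-zero _ y₁) (lerp-zero _ z₁))

separatingForm⇒disjoint : ∀ f {p} u v u′ v′ →
  evalℚ f u ⊔ evalℚ f v < evalℚ f u′ ⊓ evalℚ f v′ →
  OnSegment p u v → OnSegment p u′ v′ → ⊥
separatingForm⇒disjoint f {p} u v u′ v′ sep o@(t , 0≤t , t≤1 , _) o′@(s , 0≤s , s≤1 , _) =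
  ℚ.<-irrefl refl (begin-strict
    evalℚ f p                         ≡⟨ evalℚ-onSegment f u v o ⟩
    lerp (evalℚ f u) (evalℚ f v) t    ≤⟨ lerp-≤-⊔ {evalℚ f u} {evalℚ f v} 0≤t t≤1 ⟩
    evalℚ f u ⊔ evalℚ f v             <⟨ sep ⟩
    evalℚ f u′ ⊓ evalℚ f v′           ≤⟨ ⊓-≤-lerp {evalℚ f u′} {evalℚ f v′} 0≤s s≤1 ⟩
    lerp (evalℚ f u′) (evalℚ f v′) s  ≡⟨ evalℚ-onSegment f u′ v′ o′ ⟨
    evalℚ f p                         ∎)
  where open ℚ.≤-Reasoning

monotoneForm⇒meet : ∀ f {p} a w c →
  StrictlyMonotone _<_ (evalℚ f a) (evalℚ f w) (evalℚ f c) →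
  OnSegment p a w → OnSegment p w c → p ≡ w
monotoneForm⇒meet f a w c mono o@(_ , 0≤t , t≤1 , _) o′@(_ , 0≤s , _) =
  onSegment-start c o′ (lerp≡lerp⇒≡0 mono 0≤t t≤1 0≤s
    (trans (sym (evalℚ-onSegment f a w o)) (evalℚ-onSegment f w c o′)))

Segment : Set
Segment = Cell × Cell

Separates : LinearForm → Segment → Segment → Set
Separates f (a , b) (c , d) = eval f a ℤ.⊔ eval f b ℤ.< eval f c ℤ.⊓ eval f d

-- The first endpoint of the second segment is ignored: on a path it is w again.
MonotoneAcross : LinearForm → Segment → Segment → Set
MonotoneAcross f (a , w) (_ , c) = StrictlyMonotone (ℤ._<_ on eval f) a w c

separates⇒disjoint : ∀ f a b c d {p} → Separates f (a , b) (c , d) →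
  OnSegment p (centre a) (centre b) → OnSegment p (centre c) (centre d) → ⊥
separates⇒disjoint f a b c d sep =
  separatingForm⇒disjoint f (centre a) (centre b) (centre c) (centre d) (begin-strict
    evalℚ f (centre a) ⊔ evalℚ f (centre b)  ≡⟨ cong₂ _⊔_ (evalℚ-centre f a) (evalℚ-centre f b) ⟩
    fromℤ (eval f a) ⊔ fromℤ (eval f b)      ≤⟨ fromℤ-⊔-≤ (eval f a) (eval f b) ⟩
    fromℤ (eval f a ℤ.⊔ eval f b)            <⟨ fromℤ-mono-< sep ⟩
    fromℤ (eval f c ℤ.⊓ eval f d)            ≤⟨ fromℤ-⊓-≥ (eval f c) (eval f d) ⟩
    fromℤ (eval f c) ⊓ fromℤ (eval f d)      ≡⟨ cong₂ _⊓_ (evalℚ-centre f c) (evalℚ-centre f d) ⟨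
    evalℚ f (centre c) ⊓ evalℚ f (centre d)  ∎)
  where open ℚ.≤-Reasoning

monotoneAcross⇒meet : ∀ f a w c {p} → MonotoneAcross f (a , w) (w , c) →
  OnSegment p (centre a) (centre w) → OnSegment p (centre w) (centre c) → p ≡ centre w
monotoneAcross⇒meet f a w c mono = monotoneForm⇒meet f (centre a) (centre w) (centre c)
  (strictlyMonotone-map (evalℚ f ∘ centre) centre-< mono)
  where
  centre-< : ∀ {x y} → eval f x ℤ.< eval f y → evalℚ f (centre x) < evalℚ f (centre y)
  centre-< {x} {y} = subst₂ _<_ (sym (evalℚ-centre f x)) (sym (evalℚ-centre f y)) ∘ fromℤ-mono-<

Separated : List LinearForm → Segment → Segment → Set
Separated fs s s′ = Any (λ f → Separates f s s′ ⊎ Separates f s′ s) fs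

Monotone : List LinearForm → Segment → Segment → Set
Monotone fs s s′ = Any (λ f → MonotoneAcross f s s′) fs

separates? : ∀ f s s′ → Dec (Separates f s s′)
separates? f (a , b) (c , d) = eval f a ℤ.⊔ eval f b ℤ.<? eval f c ℤ.⊓ eval f d

monotoneAcross? : ∀ f s s′ → Dec (MonotoneAcross f s s′)
monotoneAcross? f (a , w) (_ , c) = strictlyMonotone? (λ x y → eval f x ℤ.<? eval f y) a w c

separated? : ∀ fs s s′ → Dec (Separated fs s s′)
separated? fs s s′ = any? (λ f → separates? f s s′ ⊎-dec separates? f s′ s) fs

monotone? : ∀ fs s s′ → Dec (Monotone fs s s′)
monotone? fs s s′ = any? (λ f → monotoneAcross? f s s′) fs

separated⇒disjoint : ∀ {fs} a b c d {p} → Separated fs (a , b) (c , d) →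
  OnSegment p (centre a) (centre b) → OnSegment p (centre c) (centre d) → ⊥
separated⇒disjoint a b c d sep =
  let f , sep′ = satisfied sep in
  Sum.[ separates⇒disjoint f a b c d , (λ cd<ab o o′ → separates⇒disjoint f c d a b cd<ab o′ o) ] sep′

monotone⇒meet : ∀ {fs} a w c {p} → Monotone fs (a , w) (w , c) →
  OnSegment p (centre a) (centre w) → OnSegment p (centre w) (centre c) → p ≡ centre w
monotone⇒meet a w c mono = let f , mono′ = satisfied mono in monotoneAcross⇒meet f a w c mono′

displacement : Cell → Cell → List ℕ
displacement (x , y , z) (x′ , y′ , z′) = ∣ x - x′ ∣ ∷ ∣ y - y′ ∣ ∷ ∣ z - z′ ∣ ∷ []

knightDisplacements : List (List ℕ)
knightDisplacements =
  (0 ∷ 1 ∷ 2 ∷ []) ∷ (0 ∷ 2 ∷ 1 ∷ []) ∷ (1 ∷ 0 ∷ 2 ∷ []) ∷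
  (1 ∷ 2 ∷ 0 ∷ []) ∷ (2 ∷ 0 ∷ 1 ∷ []) ∷ (2 ∷ 1 ∷ 0 ∷ []) ∷ []

knightDisplacements-↭ : ListAll.All (_↭ (0 ∷ 1 ∷ 2 ∷ [])) knightDisplacements
knightDisplacements-↭ =
  Perm.refl ∷
  Perm.prep 0 (Perm.swap 2 1 Perm.refl) ∷
  Perm.swap 1 0 Perm.refl ∷
  Perm.trans (Perm.prep 1 (Perm.swap 2 0 Perm.refl)) (Perm.swap 1 0 Perm.refl) ∷
  Perm.trans (Perm.swap 2 0 Perm.refl) (Perm.prep 0 (Perm.swap 2 1 Perm.refl)) ∷
  Perm.trans (Perm.swap 2 1 Perm.refl)
    (Perm.trans (Perm.prep 1 (Perm.swap 2 0 Perm.refl)) (Perm.swap 1 0 Perm.refl)) ∷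
  []

KnightStep : Segment → Set
KnightStep (u , w) = displacement u w ∈ knightDisplacements

knightStep? : ∀ s → Dec (KnightStep s)
knightStep? (u , w) = displacement u w ∈? knightDisplacements

knightStep⇒knightMove : ∀ u w → KnightStep (u , w) → KnightMove u w
knightStep⇒knightMove u w = ListAll.lookup knightDisplacements-↭

_≟ᶜ_ : (u w : Cell) → Dec (u ≡ w)
_≟ᶜ_ = ×-≡-dec ℕ._≟_ (×-≡-dec ℕ._≟_ ℕ._≟_)

inCube? : ∀ n → Decidable (InCube n)
inCube? n (x , y , z) = x ℕ.<? n ×-dec y ℕ.<? n ×-dec z ℕ.<? n

CertifiedPath : List LinearForm → ℕ → ∀ {L} → Vec Cell (suc L) → Set
CertifiedPath fs n vs =
  VecAll.All (InCube n) vs × Unique vs × VecAll.All KnightStep (segments vs) ×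
  Linked (Monotone fs) (segments vs) × AllNonAdjacent (Separated fs) (segments vs)

certifiedPath? : ∀ fs n {L} (vs : Vec Cell (suc L)) → Dec (CertifiedPath fs n vs)
certifiedPath? fs n vs =
  VecAll.all? (inCube? n) vs ×-dec
  allPairs? (λ u w → ¬? (u ≟ᶜ w)) vs ×-dec
  VecAll.all? knightStep? (segments vs) ×-dec
  linked? (monotone? fs) (segments vs) ×-dec
  allNonAdjacent? (separated? fs) (segments vs)

certifiedPath⇒nonCrossing : ∀ {fs n L} (vs : Vec Cell (suc L)) →
  CertifiedPath fs n vs → NonCrossingKnightPath n L
certifiedPath⇒nonCrossing {fs} {n} {L} vs (inCube , unique , steps , joints , apart) = record
  { v        = v
  ; inCube   = VecAll.lookup⁺ inCube
  ; distinct = lookup-injective unique _ _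
  ; moves    = λ i → knightStep⇒knightMove (v (inject₁ i)) (v (fsuc i))
                       (atEdge {KnightStep} i (VecAll.lookup⁺ steps i))
  ; adjacent = adjacent
  ; disjoint = disjoint
  }
  where
  v : Fin (suc L) → Cell
  v = lookup vs

  OnEdge : Fin L → Point → Set
  OnEdge i p = OnSegment p (centre (v (inject₁ i))) (centre (v (fsuc i)))

  atEdge : ∀ {P : Segment → Set} i → P (lookup (segments vs) i) → P (v (inject₁ i) , v (fsuc i))
  atEdge {P} i = subst P (lookup-segments vs i)

  atEdges : ∀ {R : Segment → Segment → Set} i j →
    R (lookup (segments vs) i) (lookup (segments vs) j) →
    R (v (inject₁ i) , v (fsuc i)) (v (inject₁ j) , v (fsuc j))
  atEdges {R} i j = subst₂ R (lookup-segments vs i) (lookup-segments vs j)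

  adjacent : ∀ i j → suc (toℕ i) ≡ toℕ j → ∀ p → OnEdge i p → OnEdge j p → p ≡ centre (v (fsuc i))
  adjacent i j i+1≡j p o o′ =
    monotone⇒meet (v (inject₁ i)) (v (fsuc i)) (v (fsuc j))
      (atEdges {Monotone fs} i j (linked-lookup joints i j i+1≡j)) o
      (subst (λ u → OnSegment p (centre (v u)) (centre (v (fsuc j)))) shared o′)
    where
    shared : inject₁ j ≡ fsuc i
    shared = Fin.toℕ-injective (trans (Fin.toℕ-inject₁ j) (sym i+1≡j))

  disjoint : ∀ i j → 2 ℕ.≤ ∣ toℕ i - toℕ j ∣ → ∀ p → OnEdge i p → OnEdge j p → ⊥
  disjoint i j far p o o′ = Sum.[
    (λ i+1<j → separated⇒disjoint (v (inject₁ i)) (v (fsuc i)) (v (inject₁ j)) (v (fsuc j))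
       (atEdges {Separated fs} i j (allNonAdjacent-lookup apart i j i+1<j)) o o′) ,
    (λ j+1<i → separated⇒disjoint (v (inject₁ j)) (v (fsuc j)) (v (inject₁ i)) (v (fsuc i))
       (atEdges {Separated fs} j i (allNonAdjacent-lookup apart j i j+1<i)) o′ o) ]
    (2≤∣m-n∣⇒1+m<n⊎1+n<m (toℕ i) (toℕ j) far)

nonCrossingKnightPath : ∀ fs n {L} (vs : Vec Cell (suc L)) →
  True (certifiedPath? fs n vs) → NonCrossingKnightPath n L
nonCrossingKnightPath fs n vs certified = certifiedPath⇒nonCrossing vs (toWitness certified)

module Witnesses where
  -- Overloaded literals are kept local: elsewhere they would block the ring solver,
  -- whose arity argument must reduce to a numeral.
  open import Agda.Builtin.FromNat using (Number; fromNat)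
  open import Agda.Builtin.FromNeg using (Negative; fromNeg)
  import Data.Nat.Literals as ℕLiterals
  import Data.Integer.Literals as ℤLiterals
  open import Data.Unit using (tt)

  instance
    _ : Number ℕ
    _ = ℕLiterals.number
    _ : Number ℤ
    _ = ℤLiterals.number
    _ : Negative ℤ
    _ = ℤLiterals.negative

  -- Normals found together with the paths; the order only affects the checking time.
  forms : List LinearForm
  forms =
    (1 , 0 , 0) ∷ (0 , 1 , 0) ∷ (0 , 0 , 1) ∷ (1 , 1 , 0) ∷ (1 , -1 , 0) ∷ (1 , 0 , 1) ∷
    (1 , 0 , -1) ∷ (0 , 1 , 1) ∷ (0 , 1 , -1) ∷ (2 , 1 , -1) ∷ (1 , -2 , -2) ∷ (2 , -1 , 2) ∷
    (2 , 2 , 1) ∷ (1 , 2 , -1) ∷ (1 , 1 , 2) ∷ (2 , -1 , -1) ∷ (2 , -2 , 1) ∷ (1 , -2 , 2) ∷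
    (1 , 1 , -2) ∷ (2 , 1 , 2) ∷ (2 , -1 , -2) ∷ (2 , -2 , -1) ∷ (1 , 2 , 2) ∷ (2 , 1 , -2) ∷
    (2 , 2 , -1) ∷ (4 , -1 , -2) ∷ (1 , 2 , 4) ∷ (1 , 2 , -2) ∷ (4 , -1 , 2) ∷ (4 , -2 , -1) ∷
    (1 , 4 , -2) ∷ (4 , -2 , 1) ∷ (4 , 1 , -2) ∷ (2 , -4 , -1) ∷ (1 , -2 , 4) ∷ (2 , 1 , -4) ∷
    (4 , 2 , -1) ∷ (4 , 1 , 2) ∷ (2 , 4 , 1) ∷ (1 , -4 , -2) ∷ (2 , -1 , -4) ∷ (1 , -2 , -4) ∷
    (2 , -4 , 1) ∷ (2 , -1 , 4) ∷ (1 , 4 , 2) ∷ (1 , 2 , -4) ∷ (2 , 4 , -1) ∷ (2 , 1 , 4) ∷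
    (4 , 2 , 1) ∷ (1 , -4 , 2) ∷
    []

  path3 : Vec Cell 16
  path3 =
    (2 , 1 , 0) ∷ (0 , 1 , 1) ∷ (2 , 1 , 2) ∷ (0 , 0 , 2) ∷ (0 , 2 , 1) ∷ (0 , 0 , 0) ∷ (1 , 2 , 0) ∷ (1 , 1 , 2) ∷
    (1 , 0 , 0) ∷ (2 , 2 , 0) ∷ (2 , 0 , 1) ∷ (1 , 2 , 1) ∷ (0 , 0 , 1) ∷ (2 , 0 , 2) ∷ (2 , 2 , 1) ∷ (0 , 2 , 0) ∷
    []

  path4 : Vec Cell 47
  path4 =
    (3 , 1 , 0) ∷ (2 , 3 , 0) ∷ (2 , 1 , 1) ∷ (2 , 0 , 3) ∷ (2 , 2 , 2) ∷ (0 , 2 , 1) ∷ (1 , 2 , 3) ∷ (1 , 1 , 1) ∷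
    (3 , 1 , 2) ∷ (2 , 1 , 0) ∷ (2 , 0 , 2) ∷ (3 , 2 , 2) ∷ (2 , 2 , 0) ∷ (3 , 0 , 0) ∷ (1 , 1 , 0) ∷ (0 , 3 , 0) ∷
    (0 , 2 , 2) ∷ (1 , 0 , 2) ∷ (0 , 0 , 0) ∷ (2 , 0 , 1) ∷ (1 , 0 , 3) ∷ (0 , 0 , 1) ∷ (1 , 2 , 1) ∷ (3 , 1 , 1) ∷
    (3 , 0 , 3) ∷ (2 , 2 , 3) ∷ (2 , 3 , 1) ∷ (1 , 3 , 3) ∷ (0 , 1 , 3) ∷ (0 , 3 , 2) ∷ (1 , 3 , 0) ∷ (3 , 3 , 1) ∷
    (2 , 3 , 3) ∷ (3 , 1 , 3) ∷ (3 , 3 , 2) ∷ (3 , 2 , 0) ∷ (3 , 0 , 1) ∷ (1 , 0 , 0) ∷ (0 , 2 , 0) ∷ (0 , 1 , 2) ∷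
    (2 , 1 , 3) ∷ (0 , 0 , 3) ∷ (0 , 1 , 1) ∷ (2 , 1 , 2) ∷ (1 , 3 , 2) ∷ (1 , 2 , 0) ∷ (1 , 0 , 1) ∷
    []

  path5 : Vec Cell 89
  path5 =
    (0 , 0 , 3) ∷ (1 , 2 , 3) ∷ (2 , 0 , 3) ∷ (4 , 0 , 2) ∷ (4 , 1 , 0) ∷ (3 , 1 , 2) ∷ (3 , 0 , 4) ∷ (1 , 1 , 4) ∷
    (1 , 0 , 2) ∷ (3 , 0 , 1) ∷ (3 , 2 , 0) ∷ (4 , 0 , 0) ∷ (2 , 0 , 1) ∷ (0 , 0 , 0) ∷ (0 , 2 , 1) ∷ (1 , 4 , 1) ∷
    (0 , 4 , 3) ∷ (0 , 2 , 4) ∷ (2 , 3 , 4) ∷ (0 , 3 , 3) ∷ (2 , 4 , 3) ∷ (0 , 4 , 4) ∷ (1 , 4 , 2) ∷ (3 , 4 , 3) ∷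
    (1 , 4 , 4) ∷ (3 , 3 , 4) ∷ (1 , 2 , 4) ∷ (0 , 2 , 2) ∷ (1 , 2 , 0) ∷ (1 , 0 , 1) ∷ (1 , 1 , 3) ∷ (1 , 3 , 4) ∷
    (1 , 2 , 2) ∷ (1 , 3 , 0) ∷ (3 , 3 , 1) ∷ (3 , 2 , 3) ∷ (3 , 4 , 4) ∷ (3 , 3 , 2) ∷ (3 , 4 , 0) ∷ (4 , 4 , 2) ∷
    (3 , 2 , 2) ∷ (3 , 3 , 0) ∷ (3 , 1 , 1) ∷ (1 , 2 , 1) ∷ (2 , 4 , 1) ∷ (2 , 3 , 3) ∷ (3 , 1 , 3) ∷ (4 , 3 , 3) ∷
    (4 , 4 , 1) ∷ (3 , 2 , 1) ∷ (3 , 0 , 2) ∷ (1 , 0 , 3) ∷ (0 , 0 , 1) ∷ (0 , 1 , 3) ∷ (2 , 1 , 2) ∷ (2 , 0 , 0) ∷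
    (0 , 1 , 0) ∷ (2 , 2 , 0) ∷ (3 , 0 , 0) ∷ (1 , 1 , 0) ∷ (0 , 1 , 2) ∷ (2 , 2 , 2) ∷ (3 , 4 , 2) ∷ (4 , 4 , 4) ∷
    (3 , 2 , 4) ∷ (4 , 0 , 4) ∷ (4 , 2 , 3) ∷ (3 , 0 , 3) ∷ (1 , 0 , 4) ∷ (0 , 0 , 2) ∷ (0 , 1 , 4) ∷ (2 , 0 , 4) ∷
    (4 , 0 , 3) ∷ (4 , 1 , 1) ∷ (4 , 3 , 0) ∷ (2 , 4 , 0) ∷ (0 , 3 , 0) ∷ (0 , 4 , 2) ∷ (1 , 4 , 0) ∷ (3 , 4 , 1) ∷
    (4 , 4 , 3) ∷ (4 , 2 , 4) ∷ (4 , 3 , 2) ∷ (4 , 4 , 0) ∷ (4 , 2 , 1) ∷ (4 , 1 , 3) ∷ (2 , 1 , 4) ∷ (2 , 0 , 2) ∷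
    (4 , 0 , 1) ∷
    []

  path6 : Vec Cell 160
  path6 =
    (0 , 1 , 5) ∷ (2 , 0 , 5) ∷ (0 , 0 , 4) ∷ (0 , 1 , 2) ∷ (0 , 0 , 0) ∷ (0 , 2 , 1) ∷ (1 , 0 , 1) ∷ (0 , 0 , 3) ∷
    (2 , 0 , 4) ∷ (4 , 0 , 5) ∷ (5 , 0 , 3) ∷ (5 , 1 , 5) ∷ (3 , 0 , 5) ∷ (1 , 0 , 4) ∷ (1 , 2 , 5) ∷ (0 , 4 , 5) ∷
    (2 , 4 , 4) ∷ (0 , 5 , 4) ∷ (2 , 5 , 5) ∷ (2 , 3 , 4) ∷ (0 , 4 , 4) ∷ (1 , 2 , 4) ∷ (1 , 4 , 5) ∷ (2 , 2 , 5) ∷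
    (4 , 1 , 5) ∷ (4 , 0 , 3) ∷ (5 , 0 , 1) ∷ (3 , 0 , 0) ∷ (5 , 1 , 0) ∷ (5 , 0 , 2) ∷ (4 , 0 , 4) ∷ (5 , 2 , 4) ∷
    (4 , 4 , 4) ∷ (2 , 5 , 4) ∷ (1 , 5 , 2) ∷ (1 , 4 , 0) ∷ (3 , 5 , 0) ∷ (5 , 5 , 1) ∷ (4 , 5 , 3) ∷ (4 , 4 , 5) ∷
    (3 , 2 , 5) ∷ (3 , 0 , 4) ∷ (1 , 1 , 4) ∷ (1 , 3 , 5) ∷ (2 , 1 , 5) ∷ (0 , 2 , 5) ∷ (1 , 2 , 3) ∷ (1 , 0 , 2) ∷
    (1 , 1 , 0) ∷ (0 , 3 , 0) ∷ (0 , 4 , 2) ∷ (1 , 4 , 4) ∷ (1 , 3 , 2) ∷ (1 , 5 , 3) ∷ (1 , 4 , 1) ∷ (1 , 2 , 0) ∷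
    (2 , 0 , 0) ∷ (0 , 1 , 0) ∷ (0 , 3 , 1) ∷ (0 , 4 , 3) ∷ (0 , 2 , 4) ∷ (0 , 0 , 5) ∷ (0 , 1 , 3) ∷ (1 , 1 , 5) ∷
    (3 , 1 , 4) ∷ (3 , 3 , 5) ∷ (3 , 5 , 4) ∷ (5 , 5 , 3) ∷ (5 , 4 , 1) ∷ (5 , 2 , 0) ∷ (4 , 4 , 0) ∷ (4 , 5 , 2) ∷
    (2 , 5 , 3) ∷ (3 , 5 , 1) ∷ (3 , 3 , 0) ∷ (4 , 5 , 0) ∷ (5 , 3 , 0) ∷ (4 , 3 , 2) ∷ (5 , 5 , 2) ∷ (5 , 4 , 0) ∷
    (3 , 4 , 1) ∷ (1 , 5 , 1) ∷ (2 , 3 , 1) ∷ (1 , 1 , 1) ∷ (3 , 0 , 1) ∷ (5 , 1 , 1) ∷ (3 , 1 , 0) ∷ (3 , 0 , 2) ∷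
    (1 , 0 , 3) ∷ (0 , 2 , 3) ∷ (0 , 1 , 1) ∷ (0 , 3 , 2) ∷ (1 , 3 , 0) ∷ (3 , 2 , 0) ∷ (2 , 4 , 0) ∷ (3 , 4 , 2) ∷
    (5 , 4 , 3) ∷ (5 , 3 , 1) ∷ (4 , 5 , 1) ∷ (3 , 3 , 1) ∷ (3 , 5 , 2) ∷ (1 , 4 , 2) ∷ (0 , 2 , 2) ∷ (2 , 1 , 2) ∷
    (0 , 0 , 2) ∷ (1 , 0 , 0) ∷ (2 , 0 , 2) ∷ (4 , 0 , 1) ∷ (3 , 0 , 3) ∷ (1 , 1 , 3) ∷ (0 , 3 , 3) ∷ (0 , 1 , 4) ∷
    (2 , 2 , 4) ∷ (2 , 0 , 3) ∷ (2 , 1 , 1) ∷ (2 , 3 , 0) ∷ (2 , 5 , 1) ∷ (2 , 3 , 2) ∷ (1 , 3 , 4) ∷ (1 , 2 , 2) ∷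
    (0 , 2 , 0) ∷ (2 , 2 , 1) ∷ (4 , 1 , 1) ∷ (2 , 1 , 0) ∷ (4 , 2 , 0) ∷ (4 , 4 , 1) ∷ (4 , 2 , 2) ∷ (4 , 1 , 0) ∷
    (4 , 3 , 1) ∷ (3 , 3 , 3) ∷ (3 , 1 , 2) ∷ (5 , 1 , 3) ∷ (5 , 3 , 2) ∷ (4 , 3 , 4) ∷ (2 , 3 , 3) ∷ (2 , 5 , 2) ∷
    (0 , 5 , 1) ∷ (2 , 5 , 0) ∷ (0 , 4 , 0) ∷ (0 , 5 , 2) ∷ (1 , 5 , 4) ∷ (3 , 5 , 5) ∷ (5 , 5 , 4) ∷ (5 , 3 , 5) ∷
    (4 , 5 , 5) ∷ (2 , 4 , 5) ∷ (0 , 5 , 5) ∷ (0 , 3 , 4) ∷ (0 , 5 , 3) ∷ (0 , 4 , 1) ∷ (1 , 4 , 3) ∷ (3 , 5 , 3) ∷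
    (4 , 3 , 3) ∷ (2 , 4 , 3) ∷ (3 , 4 , 5) ∷ (5 , 4 , 4) ∷ (5 , 2 , 5) ∷ (3 , 2 , 4) ∷ (2 , 2 , 2) ∷ (4 , 1 , 2) ∷
    []

  path7 : Vec Cell 259
  path7 =
    (2 , 0 , 5) ∷ (1 , 2 , 5) ∷ (0 , 2 , 3) ∷ (1 , 2 , 1) ∷ (0 , 4 , 1) ∷ (2 , 3 , 1) ∷ (3 , 5 , 1) ∷ (1 , 5 , 0) ∷
    (1 , 6 , 2) ∷ (0 , 6 , 4) ∷ (0 , 5 , 6) ∷ (2 , 6 , 6) ∷ (0 , 6 , 5) ∷ (1 , 6 , 3) ∷ (1 , 5 , 1) ∷ (3 , 6 , 1) ∷
    (5 , 5 , 1) ∷ (5 , 3 , 2) ∷ (6 , 3 , 0) ∷ (6 , 5 , 1) ∷ (6 , 6 , 3) ∷ (6 , 4 , 2) ∷ (5 , 4 , 0) ∷ (6 , 2 , 0) ∷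
    (5 , 0 , 0) ∷ (6 , 0 , 2) ∷ (6 , 1 , 0) ∷ (6 , 3 , 1) ∷ (6 , 5 , 2) ∷ (5 , 5 , 0) ∷ (5 , 6 , 2) ∷ (6 , 6 , 0) ∷
    (4 , 6 , 1) ∷ (2 , 6 , 0) ∷ (0 , 6 , 1) ∷ (0 , 4 , 0) ∷ (1 , 6 , 0) ∷ (3 , 5 , 0) ∷ (5 , 6 , 0) ∷ (6 , 4 , 0) ∷
    (6 , 6 , 1) ∷ (5 , 6 , 3) ∷ (6 , 6 , 5) ∷ (4 , 6 , 6) ∷ (6 , 5 , 6) ∷ (6 , 6 , 4) ∷ (6 , 4 , 5) ∷ (4 , 5 , 5) ∷
    (5 , 5 , 3) ∷ (5 , 6 , 5) ∷ (3 , 6 , 6) ∷ (5 , 5 , 6) ∷ (6 , 3 , 6) ∷ (6 , 5 , 5) ∷ (4 , 6 , 5) ∷ (3 , 6 , 3) ∷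
    (2 , 6 , 5) ∷ (0 , 5 , 5) ∷ (0 , 6 , 3) ∷ (0 , 5 , 1) ∷ (0 , 3 , 0) ∷ (0 , 1 , 1) ∷ (2 , 0 , 1) ∷ (4 , 0 , 2) ∷
    (4 , 1 , 4) ∷ (5 , 1 , 6) ∷ (5 , 0 , 4) ∷ (6 , 2 , 4) ∷ (5 , 2 , 6) ∷ (4 , 0 , 6) ∷ (4 , 2 , 5) ∷ (4 , 4 , 6) ∷
    (5 , 4 , 4) ∷ (5 , 5 , 2) ∷ (4 , 5 , 4) ∷ (4 , 4 , 2) ∷ (6 , 3 , 2) ∷ (5 , 1 , 2) ∷ (4 , 1 , 0) ∷ (2 , 1 , 1) ∷
    (1 , 3 , 1) ∷ (3 , 2 , 1) ∷ (5 , 3 , 1) ∷ (5 , 2 , 3) ∷ (4 , 4 , 3) ∷ (4 , 3 , 5) ∷ (2 , 4 , 5) ∷ (2 , 6 , 4) ∷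
    (2 , 5 , 2) ∷ (2 , 4 , 0) ∷ (2 , 2 , 1) ∷ (2 , 0 , 2) ∷ (3 , 0 , 4) ∷ (1 , 0 , 3) ∷ (1 , 2 , 4) ∷ (1 , 4 , 5) ∷
    (3 , 5 , 5) ∷ (2 , 5 , 3) ∷ (0 , 5 , 4) ∷ (1 , 5 , 6) ∷ (2 , 5 , 4) ∷ (4 , 6 , 4) ∷ (3 , 6 , 2) ∷ (3 , 5 , 4) ∷
    (4 , 5 , 6) ∷ (5 , 5 , 4) ∷ (5 , 3 , 5) ∷ (5 , 1 , 4) ∷ (6 , 3 , 4) ∷ (4 , 4 , 4) ∷ (3 , 4 , 6) ∷ (4 , 2 , 6) ∷
    (5 , 4 , 6) ∷ (6 , 2 , 6) ∷ (5 , 0 , 6) ∷ (6 , 0 , 4) ∷ (6 , 1 , 6) ∷ (6 , 3 , 5) ∷ (6 , 5 , 4) ∷ (6 , 3 , 3) ∷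
    (6 , 1 , 2) ∷ (5 , 1 , 0) ∷ (4 , 3 , 0) ∷ (3 , 1 , 0) ∷ (1 , 0 , 0) ∷ (0 , 2 , 0) ∷ (0 , 0 , 1) ∷ (2 , 0 , 0) ∷
    (4 , 0 , 1) ∷ (6 , 1 , 1) ∷ (6 , 0 , 3) ∷ (6 , 1 , 5) ∷ (6 , 2 , 3) ∷ (6 , 4 , 4) ∷ (5 , 6 , 4) ∷ (4 , 6 , 2) ∷
    (2 , 6 , 1) ∷ (0 , 6 , 2) ∷ (1 , 4 , 2) ∷ (2 , 6 , 2) ∷ (1 , 6 , 4) ∷ (0 , 4 , 4) ∷ (0 , 5 , 2) ∷ (0 , 3 , 1) ∷
    (2 , 3 , 0) ∷ (1 , 1 , 0) ∷ (0 , 1 , 2) ∷ (0 , 0 , 4) ∷ (1 , 0 , 6) ∷ (0 , 2 , 6) ∷ (0 , 0 , 5) ∷ (0 , 1 , 3) ∷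
    (1 , 1 , 1) ∷ (3 , 0 , 1) ∷ (5 , 1 , 1) ∷ (5 , 0 , 3) ∷ (5 , 1 , 5) ∷ (5 , 3 , 6) ∷ (5 , 5 , 5) ∷ (3 , 6 , 5) ∷
    (1 , 5 , 5) ∷ (1 , 3 , 6) ∷ (2 , 5 , 6) ∷ (0 , 4 , 6) ∷ (0 , 2 , 5) ∷ (1 , 0 , 5) ∷ (3 , 0 , 6) ∷ (5 , 0 , 5) ∷
    (6 , 2 , 5) ∷ (5 , 4 , 5) ∷ (6 , 4 , 3) ∷ (5 , 4 , 1) ∷ (5 , 2 , 0) ∷ (5 , 0 , 1) ∷ (3 , 0 , 0) ∷ (4 , 2 , 0) ∷
    (6 , 2 , 1) ∷ (4 , 1 , 1) ∷ (5 , 1 , 3) ∷ (5 , 2 , 1) ∷ (3 , 2 , 0) ∷ (4 , 4 , 0) ∷ (2 , 5 , 0) ∷ (1 , 3 , 0) ∷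
    (3 , 4 , 0) ∷ (1 , 4 , 1) ∷ (0 , 4 , 3) ∷ (0 , 3 , 5) ∷ (1 , 1 , 5) ∷ (3 , 1 , 6) ∷ (1 , 2 , 6) ∷ (2 , 0 , 6) ∷
    (4 , 1 , 6) ∷ (2 , 2 , 6) ∷ (0 , 3 , 6) ∷ (1 , 1 , 6) ∷ (1 , 0 , 4) ∷ (3 , 0 , 5) ∷ (4 , 0 , 3) ∷ (6 , 1 , 3) ∷
    (5 , 3 , 3) ∷ (6 , 5 , 3) ∷ (4 , 6 , 3) ∷ (4 , 5 , 1) ∷ (6 , 4 , 1) ∷ (4 , 3 , 1) ∷ (4 , 5 , 0) ∷ (5 , 3 , 0) ∷
    (3 , 3 , 1) ∷ (3 , 5 , 2) ∷ (3 , 6 , 0) ∷ (3 , 4 , 1) ∷ (5 , 4 , 2) ∷ (6 , 6 , 2) ∷ (4 , 5 , 2) ∷ (2 , 5 , 1) ∷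
    (0 , 5 , 0) ∷ (1 , 5 , 2) ∷ (1 , 4 , 0) ∷ (0 , 4 , 2) ∷ (0 , 2 , 1) ∷ (0 , 0 , 2) ∷ (2 , 0 , 3) ∷ (1 , 0 , 1) ∷
    (1 , 2 , 0) ∷ (0 , 2 , 2) ∷ (0 , 1 , 4) ∷ (0 , 3 , 3) ∷ (1 , 5 , 3) ∷ (1 , 6 , 5) ∷ (1 , 4 , 6) ∷ (3 , 4 , 5) ∷
    (3 , 6 , 4) ∷ (3 , 5 , 6) ∷ (2 , 3 , 6) ∷ (2 , 1 , 5) ∷ (4 , 0 , 5) ∷ (3 , 2 , 5) ∷ (5 , 2 , 4) ∷ (5 , 4 , 3) ∷
    (3 , 4 , 2) ∷ (1 , 3 , 2) ∷ (0 , 3 , 4) ∷ (1 , 5 , 4) ∷ (3 , 4 , 4) ∷ (1 , 3 , 4) ∷ (1 , 1 , 3) ∷ (0 , 1 , 5) ∷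
    (2 , 1 , 6) ∷ (2 , 0 , 4) ∷ (0 , 0 , 3) ∷ (1 , 2 , 3) ∷ (1 , 0 , 2) ∷ (3 , 1 , 2) ∷ (5 , 2 , 2) ∷ (3 , 2 , 3) ∷
    (3 , 1 , 1) ∷ (3 , 3 , 0) ∷ (2 , 1 , 0) ∷
    []

  path8 : Vec Cell 396
  path8 =
    (5 , 0 , 7) ∷ (5 , 1 , 5) ∷ (5 , 0 , 3) ∷ (4 , 0 , 1) ∷ (6 , 0 , 2) ∷ (5 , 0 , 4) ∷ (4 , 0 , 2) ∷ (6 , 1 , 2) ∷
    (4 , 1 , 1) ∷ (5 , 1 , 3) ∷ (7 , 2 , 3) ∷ (6 , 2 , 5) ∷ (6 , 4 , 6) ∷ (6 , 6 , 5) ∷ (7 , 6 , 3) ∷ (7 , 5 , 5) ∷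
    (6 , 5 , 7) ∷ (5 , 3 , 7) ∷ (5 , 1 , 6) ∷ (6 , 3 , 6) ∷ (4 , 3 , 7) ∷ (2 , 3 , 6) ∷ (0 , 3 , 5) ∷ (0 , 5 , 4) ∷
    (0 , 6 , 2) ∷ (0 , 4 , 1) ∷ (1 , 2 , 1) ∷ (0 , 2 , 3) ∷ (0 , 4 , 2) ∷ (1 , 4 , 0) ∷ (3 , 5 , 0) ∷ (3 , 7 , 1) ∷
    (1 , 6 , 1) ∷ (0 , 6 , 3) ∷ (1 , 6 , 5) ∷ (3 , 7 , 5) ∷ (3 , 5 , 6) ∷ (2 , 7 , 6) ∷ (4 , 6 , 6) ∷ (4 , 7 , 4) ∷
    (6 , 6 , 4) ∷ (5 , 6 , 6) ∷ (7 , 6 , 5) ∷ (5 , 7 , 5) ∷ (6 , 7 , 3) ∷ (7 , 5 , 3) ∷ (7 , 3 , 2) ∷ (6 , 3 , 0) ∷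
    (4 , 2 , 0) ∷ (2 , 3 , 0) ∷ (0 , 3 , 1) ∷ (0 , 1 , 2) ∷ (1 , 1 , 4) ∷ (0 , 3 , 4) ∷ (0 , 5 , 3) ∷ (1 , 7 , 3) ∷
    (2 , 7 , 5) ∷ (0 , 6 , 5) ∷ (0 , 4 , 6) ∷ (1 , 2 , 6) ∷ (2 , 0 , 6) ∷ (4 , 1 , 6) ∷ (4 , 0 , 4) ∷ (3 , 0 , 2) ∷
    (2 , 2 , 2) ∷ (0 , 3 , 2) ∷ (2 , 3 , 1) ∷ (1 , 3 , 3) ∷ (1 , 1 , 2) ∷ (2 , 1 , 4) ∷ (2 , 0 , 2) ∷ (1 , 2 , 2) ∷
    (0 , 2 , 4) ∷ (1 , 0 , 4) ∷ (1 , 2 , 5) ∷ (2 , 4 , 5) ∷ (2 , 5 , 7) ∷ (2 , 6 , 5) ∷ (1 , 6 , 3) ∷ (0 , 4 , 3) ∷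
    (1 , 2 , 3) ∷ (2 , 2 , 1) ∷ (1 , 4 , 1) ∷ (0 , 6 , 1) ∷ (0 , 7 , 3) ∷ (1 , 7 , 5) ∷ (3 , 7 , 6) ∷ (1 , 7 , 7) ∷
    (0 , 7 , 5) ∷ (0 , 6 , 7) ∷ (2 , 7 , 7) ∷ (4 , 7 , 6) ∷ (6 , 6 , 6) ∷ (6 , 4 , 7) ∷ (5 , 2 , 7) ∷ (7 , 3 , 7) ∷
    (7 , 4 , 5) ∷ (7 , 2 , 6) ∷ (7 , 1 , 4) ∷ (6 , 1 , 6) ∷ (6 , 3 , 7) ∷ (7 , 5 , 7) ∷ (6 , 7 , 7) ∷ (7 , 7 , 5) ∷
    (7 , 6 , 7) ∷ (7 , 4 , 6) ∷ (6 , 2 , 6) ∷ (7 , 2 , 4) ∷ (6 , 0 , 4) ∷ (5 , 0 , 6) ∷ (7 , 1 , 6) ∷ (7 , 0 , 4) ∷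
    (7 , 1 , 2) ∷ (6 , 1 , 0) ∷ (7 , 3 , 0) ∷ (7 , 1 , 1) ∷ (7 , 0 , 3) ∷ (6 , 0 , 1) ∷ (4 , 0 , 0) ∷ (2 , 1 , 0) ∷
    (0 , 1 , 1) ∷ (0 , 3 , 0) ∷ (1 , 1 , 0) ∷ (3 , 0 , 0) ∷ (1 , 0 , 1) ∷ (0 , 0 , 3) ∷ (0 , 1 , 5) ∷ (1 , 1 , 7) ∷
    (0 , 3 , 7) ∷ (0 , 1 , 6) ∷ (0 , 0 , 4) ∷ (1 , 0 , 6) ∷ (3 , 0 , 7) ∷ (5 , 1 , 7) ∷ (7 , 2 , 7) ∷ (6 , 0 , 7) ∷
    (7 , 0 , 5) ∷ (7 , 1 , 7) ∷ (7 , 3 , 6) ∷ (6 , 3 , 4) ∷ (6 , 1 , 3) ∷ (4 , 0 , 3) ∷ (4 , 1 , 5) ∷ (4 , 2 , 7) ∷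
    (4 , 0 , 6) ∷ (5 , 2 , 6) ∷ (3 , 2 , 5) ∷ (3 , 3 , 7) ∷ (2 , 1 , 7) ∷ (1 , 3 , 7) ∷ (1 , 4 , 5) ∷ (2 , 4 , 7) ∷
    (2 , 2 , 6) ∷ (2 , 0 , 5) ∷ (1 , 0 , 3) ∷ (1 , 2 , 4) ∷ (0 , 4 , 4) ∷ (1 , 4 , 6) ∷ (3 , 3 , 6) ∷ (2 , 1 , 6) ∷
    (1 , 3 , 6) ∷ (0 , 5 , 6) ∷ (2 , 4 , 6) ∷ (2 , 2 , 5) ∷ (3 , 0 , 5) ∷ (1 , 1 , 5) ∷ (1 , 2 , 7) ∷ (1 , 3 , 5) ∷
    (1 , 5 , 4) ∷ (1 , 4 , 2) ∷ (1 , 3 , 4) ∷ (1 , 1 , 3) ∷ (2 , 1 , 5) ∷ (2 , 0 , 3) ∷ (3 , 0 , 1) ∷ (1 , 1 , 1) ∷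
    (1 , 3 , 0) ∷ (1 , 5 , 1) ∷ (0 , 7 , 1) ∷ (0 , 5 , 0) ∷ (1 , 7 , 0) ∷ (0 , 7 , 2) ∷ (1 , 7 , 4) ∷ (1 , 5 , 5) ∷
    (3 , 5 , 4) ∷ (3 , 6 , 2) ∷ (2 , 6 , 0) ∷ (1 , 6 , 2) ∷ (3 , 6 , 3) ∷ (5 , 5 , 3) ∷ (4 , 5 , 5) ∷ (3 , 3 , 5) ∷
    (5 , 4 , 5) ∷ (4 , 2 , 5) ∷ (4 , 4 , 6) ∷ (6 , 5 , 6) ∷ (5 , 3 , 6) ∷ (5 , 5 , 5) ∷ (6 , 5 , 3) ∷ (4 , 6 , 3) ∷
    (2 , 6 , 2) ∷ (2 , 7 , 4) ∷ (4 , 7 , 3) ∷ (4 , 6 , 1) ∷ (6 , 5 , 1) ∷ (6 , 6 , 3) ∷ (5 , 6 , 5) ∷ (3 , 6 , 4) ∷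
    (5 , 6 , 3) ∷ (3 , 7 , 3) ∷ (3 , 6 , 5) ∷ (2 , 6 , 3) ∷ (2 , 5 , 5) ∷ (0 , 4 , 5) ∷ (0 , 6 , 4) ∷ (1 , 4 , 4) ∷
    (2 , 6 , 4) ∷ (2 , 5 , 6) ∷ (2 , 4 , 4) ∷ (3 , 4 , 6) ∷ (4 , 2 , 6) ∷ (5 , 4 , 6) ∷ (7 , 4 , 7) ∷ (6 , 4 , 5) ∷
    (7 , 4 , 3) ∷ (7 , 2 , 2) ∷ (6 , 2 , 4) ∷ (7 , 4 , 4) ∷ (5 , 5 , 4) ∷ (4 , 5 , 6) ∷ (4 , 3 , 5) ∷ (3 , 1 , 5) ∷
    (5 , 2 , 5) ∷ (6 , 2 , 3) ∷ (6 , 3 , 1) ∷ (7 , 5 , 1) ∷ (5 , 5 , 0) ∷ (6 , 5 , 2) ∷ (6 , 4 , 0) ∷ (4 , 3 , 0) ∷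
    (2 , 4 , 0) ∷ (2 , 6 , 1) ∷ (4 , 7 , 1) ∷ (4 , 5 , 0) ∷ (4 , 6 , 2) ∷ (2 , 7 , 2) ∷ (1 , 5 , 2) ∷ (1 , 6 , 4) ∷
    (3 , 7 , 4) ∷ (5 , 6 , 4) ∷ (5 , 5 , 6) ∷ (3 , 6 , 6) ∷ (3 , 4 , 7) ∷ (3 , 5 , 5) ∷ (4 , 7 , 5) ∷ (5 , 7 , 3) ∷
    (5 , 6 , 1) ∷ (5 , 4 , 0) ∷ (7 , 4 , 1) ∷ (6 , 4 , 3) ∷ (6 , 3 , 5) ∷ (6 , 1 , 4) ∷ (4 , 1 , 3) ∷ (2 , 1 , 2) ∷
    (2 , 2 , 0) ∷ (2 , 0 , 1) ∷ (2 , 1 , 3) ∷ (4 , 1 , 4) ∷ (2 , 2 , 4) ∷ (3 , 0 , 4) ∷ (3 , 1 , 6) ∷ (3 , 2 , 4) ∷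
    (5 , 1 , 4) ∷ (5 , 3 , 5) ∷ (6 , 3 , 3) ∷ (6 , 4 , 1) ∷ (6 , 2 , 0) ∷ (4 , 1 , 0) ∷ (2 , 1 , 1) ∷ (0 , 2 , 1) ∷
    (0 , 4 , 0) ∷ (1 , 6 , 0) ∷ (3 , 7 , 0) ∷ (1 , 7 , 1) ∷ (1 , 5 , 0) ∷ (3 , 6 , 0) ∷ (5 , 7 , 0) ∷ (7 , 7 , 1) ∷
    (7 , 5 , 0) ∷ (6 , 7 , 0) ∷ (4 , 6 , 0) ∷ (6 , 5 , 0) ∷ (6 , 7 , 1) ∷ (7 , 7 , 3) ∷ (7 , 6 , 1) ∷ (7 , 4 , 0) ∷
    (6 , 6 , 0) ∷ (7 , 6 , 2) ∷ (7 , 7 , 4) ∷ (7 , 6 , 6) ∷ (5 , 6 , 7) ∷ (3 , 7 , 7) ∷ (1 , 6 , 7) ∷ (0 , 4 , 7) ∷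
    (0 , 6 , 6) ∷ (0 , 7 , 4) ∷ (1 , 7 , 6) ∷ (1 , 5 , 7) ∷ (0 , 5 , 5) ∷ (0 , 3 , 6) ∷ (1 , 1 , 6) ∷ (3 , 1 , 7) ∷
    (1 , 0 , 7) ∷ (0 , 2 , 7) ∷ (0 , 0 , 6) ∷ (2 , 0 , 7) ∷ (4 , 1 , 7) ∷ (6 , 2 , 7) ∷ (6 , 0 , 6) ∷ (4 , 0 , 7) ∷
    (6 , 1 , 7) ∷ (7 , 1 , 5) ∷ (5 , 0 , 5) ∷ (3 , 0 , 6) ∷ (1 , 0 , 5) ∷ (0 , 2 , 5) ∷ (0 , 1 , 3) ∷ (0 , 0 , 1) ∷
    (0 , 2 , 0) ∷ (1 , 0 , 0) ∷ (0 , 0 , 2) ∷ (0 , 1 , 4) ∷ (0 , 2 , 6) ∷ (2 , 2 , 7) ∷ (1 , 4 , 7) ∷ (1 , 6 , 6) ∷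
    (3 , 6 , 7) ∷ (4 , 4 , 7) ∷ (2 , 3 , 7) ∷ (3 , 5 , 7) ∷ (1 , 5 , 6) ∷ (0 , 7 , 6) ∷ (2 , 6 , 6) ∷ (4 , 6 , 7) ∷
    (5 , 4 , 7) ∷ (6 , 6 , 7) ∷ (4 , 7 , 7) ∷ (6 , 7 , 6) ∷ (7 , 5 , 6) ∷ (7 , 6 , 4) ∷ (5 , 7 , 4) ∷ (6 , 7 , 2) ∷
    (7 , 5 , 2) ∷ (7 , 3 , 1) ∷ (6 , 1 , 1) ∷ (6 , 0 , 3) ∷ (6 , 1 , 5) ∷ (4 , 0 , 5) ∷ (2 , 0 , 4) ∷ (1 , 0 , 2) ∷
    (0 , 2 , 2) ∷ (1 , 2 , 0) ∷ (3 , 1 , 0) ∷ (5 , 0 , 0) ∷ (7 , 1 , 0) ∷ (7 , 0 , 2) ∷ (6 , 0 , 0) ∷ (6 , 2 , 1) ∷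
    (5 , 0 , 1) ∷ (5 , 2 , 0) ∷ (7 , 2 , 1) ∷ (7 , 1 , 3) ∷ (7 , 2 , 5) ∷ (7 , 3 , 3) ∷ (7 , 5 , 4) ∷ (7 , 3 , 5) ∷
    (6 , 5 , 5) ∷ (5 , 5 , 7) ∷ (5 , 7 , 6) ∷ (6 , 7 , 4) ∷ (6 , 6 , 2) ∷ (5 , 6 , 0) ∷ (5 , 7 , 2) ∷ (4 , 7 , 0) ∷
    (2 , 7 , 1) ∷ (4 , 7 , 2) ∷ (2 , 7 , 3) ∷ (1 , 5 , 3) ∷ (0 , 5 , 1) ∷ (2 , 5 , 0) ∷ (4 , 5 , 1) ∷ (2 , 5 , 2) ∷
    (1 , 3 , 2) ∷ (0 , 5 , 2) ∷ (0 , 3 , 3) ∷ (2 , 3 , 4) ∷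
    []

open Witnesses

mainTheorem1 : All (λ { (n , L) → NonCrossingKnightPath n L })
                 ((3 , 15) ∷ (4 , 46) ∷ (5 , 88) ∷ (6 , 159) ∷ (7 , 258) ∷ (8 , 395) ∷ [])
mainTheorem1 =
  nonCrossingKnightPath forms 3 path3 _ ∷
  nonCrossingKnightPath forms 4 path4 _ ∷
  nonCrossingKnightPath forms 5 path5 _ ∷
  nonCrossingKnightPath forms 6 path6 _ ∷
  nonCrossingKnightPath forms 7 path7 _ ∷
  nonCrossingKnightPath forms 8 path8 _ ∷ []
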